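{- Fix an integer $k\geq 3$ and let $A_n$, $\bar A_n$ ($n\geq 1$) be the antiregular $k$-hypergraphs defined in the context. Then $$I(A_i;x)=(1+x)^i\quad\text{for }1\leq i\leq k-1,$$ and for every integer $n\geq k-1$, $$I(\bar A_{n+1};x)=(1+x)\,I(A_n;x),\qquad I(A_{n+1};x)=I(\bar A_n;x)+\sum_{i=1}^{k-1}\binom{n}{i-1}x^i .$$
   Context: All hypergraphs are $k$-uniform: every hyperedge is a set of exactly $k$ vertices. For a binary string $b=b_1b_2\cdots b_n$, let $H(b)$ be the $k$-uniform hypergraph on vertex set $\{1,\dots,n\}$ obtained by adding the vertices $1,2,\dots,n$ in this order, where vertex $j$ is added as an isolated vertex (no new hyperedges) if $b_j=0$, and as a dominating vertex if $b_j=1$, meaning that every set $\{j\}\cup S$ with $S$ a $(k-1)$-element subset of $\{1,\dots,j-1\}$ is added as a hyperedge. Equivalently, a $k$-subset of $\{1,\dots,n\}$ is a hyperedge of $H(b)$ iff its largest element $j$ satisfies $b_j=1$. Antiregular $k$-hypergraphs: for $1\le n\leq k-1$, $A_n=\bar A_n$ is the hypergraph with $n$ vertices and no hyperedges. For $n\geq k$, $A_n=H(b)$ where $b$ has length $n$, $b_1=\dots=b_{k-1}=0$, the bits $b_k,b_{k+1},\dots,b_n$ alternate ($b_{j+1}\neq b_j$ for $k\le j<n$), and $b_n=1$; $\bar A_n$ is defined in the same way but with $b_n=0$. A vertex subset $W$ of a hypergraph $H$ is independent if it contains no hyperedge of $H$; the independence polynomial is $I(H;x)=\sum_{W\text{ independent}}x^{|W|}$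 (the empty set included). -}

module Defs where

open import Data.Bool using (Bool; true; false; _∧_; not; if_then_else_)
open import Data.Nat using (ℕ; zero; suc; _+_; _∸_; _<ᵇ_; _≡ᵇ_)
open import Data.Nat.Combinatorics using (_C_)
open import Data.Fin using (Fin; zero; suc; toℕ)
open import Data.Vec using (Vec; []; _∷_; lookup; tabulate)
open import Data.List using (List; []; _∷_; map; _++_; length; filterᵇ)
open import Data.Bool.ListAction using (any)
open import Data.Maybe using (Maybe; just; nothing)
open import Relation.Binary.PropositionalEquality using (_≡_)

-- Vertex subsets of {1,…,n}: Vec Bool n, position i (0-based) ↔ vertex i+1.

VSet : ℕ → Set
VSet n = Vec Bool n

allSets : (n : ℕ) → List (VSet n)
allSets zero = [] ∷ []
allSets (suc n) = map (false ∷_) (allSets n) ++ map (true ∷_) (allSets n)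

card : ∀ {n} → VSet n → ℕ
card [] = 0
card (false ∷ xs) = card xs
card (true ∷ xs) = suc (card xs)

_⊆ᵇ_ : ∀ {n} → VSet n → VSet n → Bool
[] ⊆ᵇ [] = true
(true ∷ xs) ⊆ᵇ (false ∷ ys) = false
(_ ∷ xs) ⊆ᵇ (_ ∷ ys) = xs ⊆ᵇ ys

largest : ∀ {n} → VSet n → Maybe (Fin n)
largest [] = nothing
largest (x ∷ xs) with largest xs
... | just j = just (suc j)
... | nothing = if x then just zero else nothing

-- k-uniform hypergraphs on vertex set {1,…,n}, given by the (decidable)
-- set of hyperedges; every hyperedge has exactly k vertices.

record Hypergraph (k n : ℕ) : Set where
  field
    edge : VSet n → Bool

open Hypergraph public

H : (k : ℕ) {n : ℕ} → Vec Bool n → Hypergraph k n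
H k b .edge e with largest e
... | just j = (card e ≡ᵇ k) ∧ lookup b j
... | nothing = false

-- antiregular bit strings.  For vertex j (1-based) of a string of
-- length n:  b_j = 0 if j ≤ k-1; otherwise bits alternate and b_n = last.

even : ℕ → Bool
even zero = true
even (suc m) = not (even m)

antiBits : (k n : ℕ) → Bool → Vec Bool n
antiBits k n last = tabulate λ (i : Fin n) →
  let j = suc (toℕ i) in
  if j <ᵇ k then false
  else (if even (n ∸ j) then last else not last)

-- A_n and Ā_n (for n ≤ k-1 both are edgeless, as the bits are all 0)
A : (k n : ℕ) → Hypergraph k n
A k n = H k (antiBits k n true)

Abar : (k n : ℕ) → Hypergraph k n
Abar k n = H k (antiBits k n false)

-- Polynomials with natural coefficients, as coefficient sequences
-- (p m = coefficient of x^m); equality is coefficientwise.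

Poly : Set
Poly = ℕ → ℕ

_≈ₚ_ : Poly → Poly → Set
p ≈ₚ q = ∀ m → p m ≡ q m

_+ₚ_ : Poly → Poly → Poly
(p +ₚ q) m = p m + q m

zeroₚ : Poly
zeroₚ _ = 0

oneₚ : Poly
oneₚ zero = 1
oneₚ (suc _) = 0

mono : ℕ → ℕ → Poly
mono c i m = if m ≡ᵇ i then c else 0

onePlusX* : Poly → Poly
onePlusX* p zero = p zero
onePlusX* p (suc m) = p (suc m) + p m

onePlusX^ : ℕ → Poly
onePlusX^ zero = oneₚ
onePlusX^ (suc i) = onePlusX* (onePlusX^ i)

-- Σ_{i=a}^{a+len-1} f i
sumFrom : ℕ → ℕ → (ℕ → Poly) → Poly
sumFrom a zero f = zeroₚ
sumFrom a (suc len) f = f a +ₚ sumFrom (suc a) len f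

independent : ∀ {k n} → Hypergraph k n → VSet n → Bool
independent {n = n} G W = not (any (λ e → (e ⊆ᵇ W) ∧ edge G e) (allSets n))

I : ∀ {k n} → Hypergraph k n → Poly
I {n = n} G m = length (filterᵇ (λ W → independent G W ∧ (card W ≡ᵇ m)) (allSets n))

{-# OPTIONS --safe #-}
-- H(b) is built by appending vertices, so it suffices to follow I when a vertex v is appended
-- to a hypergraph on n vertices. An independent set either avoids v, and is then an independent
-- set W of the old hypergraph, or has the form W ∪ {v}. If v is isolated, W ∪ {v} is independent
-- exactly when W is, which multiplies I by 1 + x. If v is dominating, W ∪ {v} is independent iff
-- W has no (k-1)-subset, i.e. |W| ≤ k - 2, and such a W is independent anyway; this contributes
-- Σ C(n, i-1) x^i over 1 ≤ i ≤ k-1. Finally Ā_{n+1} is A_n followed by 0, A_{n+1} is Ā_n followed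
-- by 1 (for n ≥ k-1), and A_i for i ≤ k-1 is edgeless.
module Submission where

open import Defs
open import Data.Nat using (ℕ; zero; suc; _+_; _∸_; _≤_; _<_; _<ᵇ_; _≡ᵇ_; z≤n; s≤s)
open import Data.Nat.Combinatorics using (_C_; nCk+nC[k+1]≡[n+1]C[k+1])
open import Data.Nat.ListAction using (sum)
open import Data.Nat.Properties
  using (+-0-commutativeMonoid; +-comm; +-identityʳ; ≡ᵇ⇒≡; <⇒<ᵇ; <ᵇ⇒<; m<n⇒m<1+n; ≤-<-trans;
         m≤n⇒m≤1+n; n∸n≡0; <⇒≱)
open import Data.Product using (_×_; _,_; proj₁)
open import Data.Empty using (⊥-elim)
open import Data.Bool using (Bool; true; false; _∧_; _∨_; not; if_then_else_; T)
open import Data.Bool.Properties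
  using (∨-commutativeMonoid; ∧-comm; ∧-zeroʳ; ∧-identityʳ; ∨-identityʳ; if-not; if-eta;
         not-involutive; T-≡; T-∧; ∨-∧-booleanAlgebra)
open import Algebra.Bundles using (CommutativeMonoid)
open import Algebra.Lattice.Properties.BooleanAlgebra ∨-∧-booleanAlgebra using (deMorgan₂)
open import Data.Fin using (Fin; zero; suc; toℕ; inject₁; fromℕ)
open import Data.Fin.Properties using (toℕ<n; toℕ-inject₁; toℕ-fromℕ)
open import Data.List as List using (List; []; _∷_; _++_; length; filterᵇ)
open import Data.Maybe as Maybe using (just; nothing)
open import Data.Vec using (Vec; []; _∷_; _∷ʳ_; lookup; tabulate; replicate)
open import Data.Vec.Properties using (tabulate-cong; tabulate∘lookup; lookup-replicate)
open import Function using (Equivalence)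
open import Relation.Binary.PropositionalEquality
  using (_≡_; refl; sym; trans; cong; cong₂; subst; module ≡-Reasoning)

module BigOperator {c ℓ} (M : CommutativeMonoid c ℓ) where
  open CommutativeMonoid M renaming (refl to ≈-refl; sym to ≈-sym; trans to ≈-trans)
  open import Algebra.Properties.CommutativeSemigroup commutativeSemigroup using (interchange)
  open import Relation.Binary.Reasoning.Setoid setoid

  private
    fold : ∀ {A : Set} → (A → Carrier) → List A → Carrier
    fold f xs = List.foldr _∙_ ε (List.map f xs)

    fold-++ : ∀ {A : Set} (f : A → Carrier) xs ys → fold f (xs ++ ys) ≈ fold f xs ∙ fold f ys
    fold-++ f []       ys = ≈-sym (identityˡ _)
    fold-++ f (x ∷ xs) ys = ≈-trans (∙-congˡ (fold-++ f xs ys)) (≈-sym (assoc _ _ _))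

    fold-map : ∀ {A B : Set} (f : B → Carrier) (g : A → B) xs →
               fold f (List.map g xs) ≡ fold (λ x → f (g x)) xs
    fold-map f g []       = refl
    fold-map f g (x ∷ xs) = cong (f (g x) ∙_) (fold-map f g xs)

    fold-cong : ∀ {A : Set} {f g : A → Carrier} → (∀ x → f x ≈ g x) → ∀ xs → fold f xs ≈ fold g xs
    fold-cong f≈g []       = ≈-refl
    fold-cong f≈g (x ∷ xs) = ∙-cong (f≈g x) (fold-cong f≈g xs)

    fold-ε : ∀ {A : Set} (xs : List A) → fold (λ _ → ε) xs ≈ ε
    fold-ε []       = ≈-refl
    fold-ε (x ∷ xs) = ≈-trans (identityˡ _) (fold-ε xs)

  ⨁ : ∀ {n} → (VSet n → Carrier) → Carrier
  ⨁ {n} f = fold f (allSets n)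

  ⨁-cong : ∀ {n} {f g : VSet n → Carrier} → (∀ W → f W ≈ g W) → ⨁ f ≈ ⨁ g
  ⨁-cong {n} f≈g = fold-cong f≈g (allSets n)

  ⨁-ε : ∀ n → ⨁ {n} (λ _ → ε) ≈ ε
  ⨁-ε n = fold-ε (allSets n)

  ⨁-∷ : ∀ {n} (f : VSet (suc n) → Carrier) →
        ⨁ f ≈ ⨁ (λ W → f (false ∷ W)) ∙ ⨁ (λ W → f (true ∷ W))
  ⨁-∷ {n} f = begin
    fold f (List.map (false ∷_) (allSets n) ++ List.map (true ∷_) (allSets n))
      ≈⟨ fold-++ f (List.map (false ∷_) (allSets n)) _ ⟩
    fold f (List.map (false ∷_) (allSets n)) ∙ fold f (List.map (true ∷_) (allSets n))
      ≡⟨ cong₂ _∙_ (fold-map f (false ∷_) (allSets n)) (fold-map f (true ∷_) (allSets n)) ⟩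
    ⨁ (λ W → f (false ∷ W)) ∙ ⨁ (λ W → f (true ∷ W)) ∎

  ⨁-∷ʳ : ∀ {n} (f : VSet (suc n) → Carrier) →
         ⨁ f ≈ ⨁ (λ W → f (W ∷ʳ false)) ∙ ⨁ (λ W → f (W ∷ʳ true))
  ⨁-∷ʳ {zero}  f = ⨁-∷ f
  ⨁-∷ʳ {suc n} f = begin
    ⨁ f
      ≈⟨ ⨁-∷ f ⟩
    ⨁ (λ W → f (false ∷ W)) ∙ ⨁ (λ W → f (true ∷ W))
      ≈⟨ ∙-cong (⨁-∷ʳ (λ W → f (false ∷ W))) (⨁-∷ʳ (λ W → f (true ∷ W))) ⟩
    (ff ∙ ft) ∙ (tf ∙ tt)
      ≈⟨ interchange ff ft tf tt ⟩
    (ff ∙ tf) ∙ (ft ∙ tt)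
      ≈⟨ ∙-cong (⨁-∷ (λ W → f (W ∷ʳ false))) (⨁-∷ (λ W → f (W ∷ʳ true))) ⟨
    ⨁ (λ W → f (W ∷ʳ false)) ∙ ⨁ (λ W → f (W ∷ʳ true)) ∎
    where
    ff ft tf tt : Carrier
    ff = ⨁ (λ W → f (false ∷ (W ∷ʳ false)))
    ft = ⨁ (λ W → f (false ∷ (W ∷ʳ true)))
    tf = ⨁ (λ W → f (true ∷ (W ∷ʳ false)))
    tt = ⨁ (λ W → f (true ∷ (W ∷ʳ true)))

open BigOperator ∨-commutativeMonoid
  renaming (⨁ to ⋁; ⨁-cong to ⋁-cong; ⨁-ε to ⋁-false; ⨁-∷ to ⋁-∷; ⨁-∷ʳ to ⋁-∷ʳ)
open BigOperator +-0-commutativeMonoid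
  renaming (⨁ to ∑; ⨁-cong to ∑-cong; ⨁-ε to ∑-zero; ⨁-∷ to ∑-∷; ⨁-∷ʳ to ∑-∷ʳ)

card-∷ʳ-false : ∀ {n} (e : VSet n) → card (e ∷ʳ false) ≡ card e
card-∷ʳ-false []          = refl
card-∷ʳ-false (false ∷ e) = card-∷ʳ-false e
card-∷ʳ-false (true ∷ e)  = cong suc (card-∷ʳ-false e)

card-∷ʳ-true : ∀ {n} (e : VSet n) → card (e ∷ʳ true) ≡ suc (card e)
card-∷ʳ-true []          = refl
card-∷ʳ-true (false ∷ e) = card-∷ʳ-true e
card-∷ʳ-true (true ∷ e)  = cong suc (card-∷ʳ-true e)

⊆ᵇ-∷ʳ-false : ∀ {n} (e W : VSet n) w → (e ∷ʳ false) ⊆ᵇ (W ∷ʳ w) ≡ e ⊆ᵇ W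
⊆ᵇ-∷ʳ-false []          []          w = refl
⊆ᵇ-∷ʳ-false (true ∷ e)  (false ∷ W) w = refl
⊆ᵇ-∷ʳ-false (true ∷ e)  (true ∷ W)  w = ⊆ᵇ-∷ʳ-false e W w
⊆ᵇ-∷ʳ-false (false ∷ e) (_ ∷ W)     w = ⊆ᵇ-∷ʳ-false e W w

⊆ᵇ-∷ʳ-true : ∀ {n} (e W : VSet n) w → (e ∷ʳ true) ⊆ᵇ (W ∷ʳ w) ≡ (e ⊆ᵇ W) ∧ w
⊆ᵇ-∷ʳ-true []          []          false = refl
⊆ᵇ-∷ʳ-true []          []          true  = refl
⊆ᵇ-∷ʳ-true (true ∷ e)  (false ∷ W) w     = refl
⊆ᵇ-∷ʳ-true (true ∷ e)  (true ∷ W)  w     = ⊆ᵇ-∷ʳ-true e W w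
⊆ᵇ-∷ʳ-true (false ∷ e) (_ ∷ W)     w     = ⊆ᵇ-∷ʳ-true e W w

⊆ᵇ⇒card≤ : ∀ {n} (e W : VSet n) → T (e ⊆ᵇ W) → card e ≤ card W
⊆ᵇ⇒card≤ []          []          _    = z≤n
⊆ᵇ⇒card≤ (true ∷ e)  (true ∷ W)  e⊆W = s≤s (⊆ᵇ⇒card≤ e W e⊆W)
⊆ᵇ⇒card≤ (false ∷ e) (true ∷ W)  e⊆W = m≤n⇒m≤1+n (⊆ᵇ⇒card≤ e W e⊆W)
⊆ᵇ⇒card≤ (false ∷ e) (false ∷ W) e⊆W = ⊆ᵇ⇒card≤ e W e⊆W

largest-∷ʳ-false : ∀ {n} (e : VSet n) → largest (e ∷ʳ false) ≡ Maybe.map inject₁ (largest e)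
largest-∷ʳ-false []      = refl
largest-∷ʳ-false (x ∷ e) rewrite largest-∷ʳ-false e with largest e | x
... | just j  | _     = refl
... | nothing | true  = refl
... | nothing | false = refl

largest-∷ʳ-true : ∀ {n} (e : VSet n) → largest (e ∷ʳ true) ≡ just (fromℕ n)
largest-∷ʳ-true []      = refl
largest-∷ʳ-true (x ∷ e) rewrite largest-∷ʳ-true e = refl

lookup-∷ʳ-inject₁ : ∀ {A : Set} {n} (b : Vec A n) c (j : Fin n) →
                    lookup (b ∷ʳ c) (inject₁ j) ≡ lookup b j
lookup-∷ʳ-inject₁ (x ∷ b) c zero    = refl
lookup-∷ʳ-inject₁ (x ∷ b) c (suc j) = lookup-∷ʳ-inject₁ b c j

lookup-∷ʳ-fromℕ : ∀ {A : Set} {n} (b : Vec A n) c → lookup (b ∷ʳ c) (fromℕ n) ≡ c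
lookup-∷ʳ-fromℕ []      c = refl
lookup-∷ʳ-fromℕ (x ∷ b) c = lookup-∷ʳ-fromℕ b c

edge⇒card≡ : ∀ k {n} (b : Vec Bool n) e → T (edge (H k b) e) → card e ≡ k
edge⇒card≡ k b e p with largest e
... | just j = ≡ᵇ⇒≡ (card e) k (proj₁ (Equivalence.to T-∧ p))

edge-∷ʳ-false : ∀ k {n} (b : Vec Bool n) c e → edge (H k (b ∷ʳ c)) (e ∷ʳ false) ≡ edge (H k b) e
edge-∷ʳ-false k b c e rewrite largest-∷ʳ-false e with largest e
... | just j  = cong₂ _∧_ (cong (_≡ᵇ k) (card-∷ʳ-false e)) (lookup-∷ʳ-inject₁ b c j)
... | nothing = refl

edge-∷ʳ-true : ∀ k {n} (b : Vec Bool n) c e →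
               edge (H k (b ∷ʳ c)) (e ∷ʳ true) ≡ (suc (card e) ≡ᵇ k) ∧ c
edge-∷ʳ-true k {n} b c e rewrite largest-∷ʳ-true e | card-∷ʳ-true e | lookup-∷ʳ-fromℕ b c = refl

⋁-∧ˡ : ∀ {n} x (g : VSet n → Bool) → ⋁ (λ e → x ∧ g e) ≡ x ∧ ⋁ g
⋁-∧ˡ {n} false g = ⋁-false n
⋁-∧ˡ     true  g = refl

<ᵇ-∨-<ᵇ-suc : ∀ c m → (c <ᵇ m) ∨ (c <ᵇ suc m) ≡ (c <ᵇ suc m)
<ᵇ-∨-<ᵇ-suc zero    zero    = refl
<ᵇ-∨-<ᵇ-suc zero    (suc m) = refl
<ᵇ-∨-<ᵇ-suc (suc c) zero    = refl
<ᵇ-∨-<ᵇ-suc (suc c) (suc m) = <ᵇ-∨-<ᵇ-suc c m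

not-<ᵇ-suc : ∀ c m → not (c <ᵇ suc m) ≡ (m <ᵇ c)
not-<ᵇ-suc zero    m       = refl
not-<ᵇ-suc (suc c) zero    = refl
not-<ᵇ-suc (suc c) (suc m) = not-<ᵇ-suc c m

has-subset-of-size : ∀ {n} (W : VSet n) c →
                     ⋁ (λ e → (e ⊆ᵇ W) ∧ (card e ≡ᵇ c)) ≡ (c <ᵇ suc (card W))
has-subset-of-size         []      zero    = refl
has-subset-of-size         []      (suc c) = refl
has-subset-of-size {suc n} (w ∷ W) c       =
  trans (⋁-∷ (λ e → (e ⊆ᵇ (w ∷ W)) ∧ (card e ≡ᵇ c))) (split w c)
  where
  split : ∀ w c →
    ⋁ (λ e → (e ⊆ᵇ W) ∧ (card e ≡ᵇ c))
      ∨ ⋁ (λ e → ((true ∷ e) ⊆ᵇ (w ∷ W)) ∧ (suc (card e) ≡ᵇ c))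
      ≡ (c <ᵇ suc (card (w ∷ W)))
  split false c       = trans (cong₂ _∨_ (has-subset-of-size W c) (⋁-false n)) (∨-identityʳ _)
  split true  zero    rewrite has-subset-of-size W zero = refl
  split true  (suc c) = trans (cong₂ _∨_ (has-subset-of-size W (suc c)) (has-subset-of-size W c))
                              (<ᵇ-∨-<ᵇ-suc c (card W))

card<k⇒independent : ∀ k {n} (b : Vec Bool n) W → card W < k → independent (H k b) W ≡ true
card<k⇒independent k {n} b W W<k = cong not (trans (⋁-cong no-edge-in-W) (⋁-false n))
  where
  no-edge-in-W : ∀ e → (e ⊆ᵇ W) ∧ edge (H k b) e ≡ false
  no-edge-in-W e with e ⊆ᵇ W in e⊆W | edge (H k b) e in isEdge
  ... | false | _     = refl
  ... | true  | false = refl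
  ... | true  | true  = ⊥-elim (<⇒≱ W<k (subst (_≤ card W) (edge⇒card≡ k b e (true⇒T isEdge))
                                                             (⊆ᵇ⇒card≤ e W (true⇒T e⊆W))))
    where
    true⇒T : ∀ {x} → x ≡ true → T x
    true⇒T = Equivalence.from T-≡

∧-rearrange : ∀ a w s c → (a ∧ w) ∧ (s ∧ c) ≡ w ∧ (c ∧ (a ∧ s))
∧-rearrange true  true  s c     = ∧-comm s c
∧-rearrange true  false s c     = refl
∧-rearrange false false s c     = refl
∧-rearrange false true  s false = refl
∧-rearrange false true  s true  = refl

independent-∷ʳ : ∀ k {n} (b : Vec Bool n) c W w →
  independent (H k (b ∷ʳ c)) (W ∷ʳ w)
    ≡ independent (H k b) W ∧ not (w ∧ (c ∧ ⋁ (λ e → (e ⊆ᵇ W) ∧ (suc (card e) ≡ᵇ k))))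
independent-∷ʳ k {n} b c W w = begin
  not (⋁ P)
    ≡⟨ cong not (⋁-∷ʳ P) ⟩
  not (⋁ (λ e → P (e ∷ʳ false)) ∨ ⋁ (λ e → P (e ∷ʳ true)))
    ≡⟨ cong not (cong₂ _∨_ (⋁-cong old-edge) (⋁-cong new-edge)) ⟩
  not (⋁ Q ∨ ⋁ (λ e → w ∧ (c ∧ R e)))
    ≡⟨ cong (λ z → not (⋁ Q ∨ z)) (trans (⋁-∧ˡ w (λ e → c ∧ R e)) (cong (w ∧_) (⋁-∧ˡ c R))) ⟩
  not (⋁ Q ∨ (w ∧ (c ∧ ⋁ R)))
    ≡⟨ deMorgan₂ (⋁ Q) _ ⟩
  not (⋁ Q) ∧ not (w ∧ (c ∧ ⋁ R)) ∎
  where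
  open ≡-Reasoning
  P : VSet (suc n) → Bool
  P e = (e ⊆ᵇ (W ∷ʳ w)) ∧ edge (H k (b ∷ʳ c)) e
  Q R : VSet n → Bool
  Q e = (e ⊆ᵇ W) ∧ edge (H k b) e
  R e = (e ⊆ᵇ W) ∧ (suc (card e) ≡ᵇ k)
  old-edge : ∀ e → P (e ∷ʳ false) ≡ Q e
  old-edge e = cong₂ _∧_ (⊆ᵇ-∷ʳ-false e W w) (edge-∷ʳ-false k b c e)
  new-edge : ∀ e → P (e ∷ʳ true) ≡ w ∧ (c ∧ R e)
  new-edge e = trans (cong₂ _∧_ (⊆ᵇ-∷ʳ-true e W w) (edge-∷ʳ-true k b c e))
                     (∧-rearrange (e ⊆ᵇ W) w (suc (card e) ≡ᵇ k) c)

independent-dominating : ∀ k' {n} (b : Vec Bool n) W →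
  independent (H (suc k') (b ∷ʳ true)) (W ∷ʳ true) ≡ (card W <ᵇ k')
independent-dominating k' b W = begin
  independent (H k (b ∷ʳ true)) (W ∷ʳ true)
    ≡⟨ independent-∷ʳ k b true W true ⟩
  independent (H k b) W ∧ not (⋁ (λ e → (e ⊆ᵇ W) ∧ (card e ≡ᵇ k')))
    ≡⟨ cong (λ z → independent (H k b) W ∧ not z) (has-subset-of-size W k') ⟩
  independent (H k b) W ∧ not (k' <ᵇ suc (card W))
    ≡⟨ cong (independent (H k b) W ∧_) (not-<ᵇ-suc k' (card W)) ⟩
  independent (H k b) W ∧ (card W <ᵇ k')
    ≡⟨ small-sets-independent (card W <ᵇ k') refl ⟩
  (card W <ᵇ k') ∎
  where
  open ≡-Reasoning
  k : ℕ
  k = suc k'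
  small-sets-independent : ∀ x → (card W <ᵇ k') ≡ x → independent (H k b) W ∧ x ≡ x
  small-sets-independent false _  = ∧-zeroʳ _
  small-sets-independent true  lt = trans (∧-identityʳ _)
    (card<k⇒independent k b W (m<n⇒m<1+n (<ᵇ⇒< (card W) k' (Equivalence.from T-≡ lt))))

count : ∀ n → (VSet n → Bool) → ℕ
count n p = ∑ {n} (λ W → if p W then 1 else 0)

count-cong : ∀ {n} {p q : VSet n → Bool} → (∀ W → p W ≡ q W) → count n p ≡ count n q
count-cong p≡q = ∑-cong (λ W → cong (if_then 1 else 0) (p≡q W))

count-∷ : ∀ {n} (p : VSet (suc n) → Bool) →
          count (suc n) p ≡ count n (λ W → p (false ∷ W)) + count n (λ W → p (true ∷ W))
count-∷ {n} p = ∑-∷ {n} (λ W → if p W then 1 else 0)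

count-∷ʳ : ∀ {n} (p : VSet (suc n) → Bool) →
           count (suc n) p ≡ count n (λ W → p (W ∷ʳ false)) + count n (λ W → p (W ∷ʳ true))
count-∷ʳ {n} p = ∑-∷ʳ {n} (λ W → if p W then 1 else 0)

count-false : ∀ n → count n (λ _ → false) ≡ 0
count-false n = ∑-zero n

length-filterᵇ : ∀ {A : Set} (p : A → Bool) xs →
                 length (filterᵇ p xs) ≡ sum (List.map (λ x → if p x then 1 else 0) xs)
length-filterᵇ p []       = refl
length-filterᵇ p (x ∷ xs) with p x
... | true  = cong suc (length-filterᵇ p xs)
... | false = length-filterᵇ p xs

I≡count : ∀ {k n} (G : Hypergraph k n) m → I G m ≡ count n (λ W → independent G W ∧ (card W ≡ᵇ m))
I≡count {n = n} G m = length-filterᵇ (λ W → independent G W ∧ (card W ≡ᵇ m)) (allSets n)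

count-card : ∀ n m → count n (λ W → card W ≡ᵇ m) ≡ n C m
count-card zero    zero    = refl
count-card zero    (suc m) = refl
count-card (suc n) m       = trans (count-∷ {n} (λ W → card W ≡ᵇ m))
  (trans (cong (_+ count n (λ W → suc (card W) ≡ᵇ m)) (count-card n m)) (pascal m))
  where
  pascal : ∀ m → n C m + count n (λ W → suc (card W) ≡ᵇ m) ≡ suc n C m
  pascal zero    = cong (n C zero +_) (count-false n)
  pascal (suc m) = trans (cong (n C suc m +_) (count-card n m))
                         (trans (+-comm (n C suc m) (n C m)) (nCk+nC[k+1]≡[n+1]C[k+1] n m))

∧-≡ᵇ-subst : ∀ (f : ℕ → Bool) x y → f x ∧ (x ≡ᵇ y) ≡ f y ∧ (x ≡ᵇ y)
∧-≡ᵇ-subst f x y with x ≡ᵇ y in x≡ᵇy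
... | false = trans (∧-zeroʳ (f x)) (sym (∧-zeroʳ (f y)))
... | true with refl ← ≡ᵇ⇒≡ x y (Equivalence.from T-≡ x≡ᵇy) = refl

count-of-size : ∀ n (f : ℕ → Bool) m →
  count n (λ W → f (card W) ∧ (card W ≡ᵇ m)) ≡ (if f m then n C m else 0)
count-of-size n f m = trans (count-cong {n} (λ W → ∧-≡ᵇ-subst f (card W) m)) (by-cases (f m))
  where
  by-cases : ∀ x → count n (λ W → x ∧ (card W ≡ᵇ m)) ≡ (if x then n C m else 0)
  by-cases false = count-false n
  by-cases true  = count-card n m

I-∷ʳ : ∀ k {n} (b : Vec Bool n) c m →
  I (H k (b ∷ʳ c)) m
    ≡ I (H k b) m + count n (λ W → independent (H k (b ∷ʳ c)) (W ∷ʳ true) ∧ (suc (card W) ≡ᵇ m))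
I-∷ʳ k {n} b c m = begin
  I (H k (b ∷ʳ c)) m
    ≡⟨ I≡count (H k (b ∷ʳ c)) m ⟩
  count (suc n) p
    ≡⟨ count-∷ʳ p ⟩
  count n (λ W → p (W ∷ʳ false)) + count n (λ W → p (W ∷ʳ true))
    ≡⟨ cong₂ _+_ (count-cong {n} without-new-vertex) (count-cong {n} with-new-vertex) ⟩
  count n (λ W → independent (H k b) W ∧ (card W ≡ᵇ m)) + count n q
    ≡⟨ cong (_+ count n q) (I≡count (H k b) m) ⟨
  I (H k b) m + count n q ∎
  where
  open ≡-Reasoning
  p : VSet (suc n) → Bool
  p W = independent (H k (b ∷ʳ c)) W ∧ (card W ≡ᵇ m)
  q : VSet n → Bool
  q W = independent (H k (b ∷ʳ c)) (W ∷ʳ true) ∧ (suc (card W) ≡ᵇ m)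
  without-new-vertex : ∀ W → p (W ∷ʳ false) ≡ independent (H k b) W ∧ (card W ≡ᵇ m)
  without-new-vertex W = cong₂ _∧_ (trans (independent-∷ʳ k b c W false) (∧-identityʳ _))
                                   (cong (_≡ᵇ m) (card-∷ʳ-false W))
  with-new-vertex : ∀ W → p (W ∷ʳ true) ≡ q W
  with-new-vertex W = cong (λ z → independent (H k (b ∷ʳ c)) (W ∷ʳ true) ∧ (z ≡ᵇ m)) (card-∷ʳ-true W)

I-isolated : ∀ k {n} (b : Vec Bool n) → I (H k (b ∷ʳ false)) ≈ₚ onePlusX* (I (H k b))
I-isolated k {n} b m = trans (I-∷ʳ k b false m) (shift m)
  where
  isolated : ∀ W → independent (H k (b ∷ʳ false)) (W ∷ʳ true) ≡ independent (H k b) W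
  isolated W = trans (independent-∷ʳ k b false W true) (∧-identityʳ _)
  shift : ∀ m →
    I (H k b) m + count n (λ W → independent (H k (b ∷ʳ false)) (W ∷ʳ true) ∧ (suc (card W) ≡ᵇ m))
      ≡ onePlusX* (I (H k b)) m
  shift zero    = trans (cong (I (H k b) zero +_) (trans (count-cong {n} (λ W → ∧-zeroʳ _)) (count-false n)))
                        (+-identityʳ _)
  shift (suc m) = cong (I (H k b) (suc m) +_)
                       (trans (count-cong {n} (λ W → cong (_∧ _) (isolated W))) (sym (I≡count (H k b) m)))

sumFrom-mono-zero : ∀ a len (g : ℕ → ℕ) → sumFrom (suc a) len (λ i → mono (g i) i) zero ≡ 0
sumFrom-mono-zero a zero      g = refl
sumFrom-mono-zero a (suc len) g = sumFrom-mono-zero (suc a) len g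

sumFrom-mono-suc : ∀ a len (g : ℕ → ℕ) m →
  sumFrom (suc a) len (λ i → mono (g i) i) (suc m) ≡ sumFrom a len (λ i → mono (g (suc i)) i) m
sumFrom-mono-suc a zero      g m = refl
sumFrom-mono-suc a (suc len) g m = cong (mono (g (suc a)) a m +_) (sumFrom-mono-suc (suc a) len g m)

sumFrom-mono : ∀ len (g : ℕ → ℕ) m →
               sumFrom 0 len (λ i → mono (g i) i) m ≡ (if m <ᵇ len then g m else 0)
sumFrom-mono zero      g m       = refl
sumFrom-mono (suc len) g zero    = trans (cong (g 0 +_) (sumFrom-mono-zero 0 len g)) (+-identityʳ (g 0))
sumFrom-mono (suc len) g (suc m) = trans (sumFrom-mono-suc 0 len g m) (sumFrom-mono len (λ i → g (suc i)) m)

I-dominating : ∀ k' {n} (b : Vec Bool n) →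
  I (H (suc k') (b ∷ʳ true)) ≈ₚ (I (H (suc k') b) +ₚ sumFrom 1 k' (λ i → mono (n C (i ∸ 1)) i))
I-dominating k' {n} b m = trans (I-∷ʳ k b true m) (cong (I (H k b) m +_) (new-sets m))
  where
  open ≡-Reasoning
  k : ℕ
  k = suc k'
  new-sets : ∀ m → count n (λ W → independent (H k (b ∷ʳ true)) (W ∷ʳ true) ∧ (suc (card W) ≡ᵇ m))
                   ≡ sumFrom 1 k' (λ i → mono (n C (i ∸ 1)) i) m
  new-sets zero    = trans (count-cong {n} (λ W → ∧-zeroʳ _))
                           (trans (count-false n) (sym (sumFrom-mono-zero 0 k' (λ i → n C (i ∸ 1)))))
  new-sets (suc m) = begin
    count n (λ W → independent (H k (b ∷ʳ true)) (W ∷ʳ true) ∧ (card W ≡ᵇ m))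
      ≡⟨ count-cong {n} (λ W → cong (_∧ (card W ≡ᵇ m)) (independent-dominating k' b W)) ⟩
    count n (λ W → (card W <ᵇ k') ∧ (card W ≡ᵇ m))
      ≡⟨ count-of-size n (_<ᵇ k') m ⟩
    (if m <ᵇ k' then n C m else 0)
      ≡⟨ sumFrom-mono k' (n C_) m ⟨
    sumFrom 0 k' (λ i → mono (n C i) i) m
      ≡⟨ sumFrom-mono-suc 0 k' (λ i → n C (i ∸ 1)) m ⟨
    sumFrom 1 k' (λ i → mono (n C (i ∸ 1)) i) (suc m) ∎

onePlusX*-cong : ∀ {p q} → p ≈ₚ q → onePlusX* p ≈ₚ onePlusX* q
onePlusX*-cong p≈q zero    = p≈q zero
onePlusX*-cong p≈q (suc m) = cong₂ _+_ (p≈q (suc m)) (p≈q m)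

replicate-∷ʳ : ∀ {A : Set} n (x : A) → replicate (suc n) x ≡ replicate n x ∷ʳ x
replicate-∷ʳ zero    x = refl
replicate-∷ʳ (suc n) x = cong (x ∷_) (replicate-∷ʳ n x)

I-edgeless : ∀ k n → I (H k (replicate n false)) ≈ₚ onePlusX^ n
I-edgeless k zero    zero    = refl
I-edgeless k zero    (suc m) = refl
I-edgeless k (suc n) m       = begin
  I (H k (replicate (suc n) false)) m          ≡⟨ cong (λ b → I (H k b) m) (replicate-∷ʳ n false) ⟩
  I (H k (replicate n false ∷ʳ false)) m       ≡⟨ I-isolated k (replicate n false) m ⟩
  onePlusX* (I (H k (replicate n false))) m    ≡⟨ onePlusX*-cong (I-edgeless k n) m ⟩
  onePlusX^ (suc n) m                          ∎
  where open ≡-Reasoning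

tabulate-∷ʳ : ∀ {A : Set} n (f : Fin (suc n) → A) →
              tabulate f ≡ tabulate (λ i → f (inject₁ i)) ∷ʳ f (fromℕ n)
tabulate-∷ʳ zero    f = refl
tabulate-∷ʳ (suc n) f = cong (f zero ∷_) (tabulate-∷ʳ n (λ i → f (suc i)))

n∸i≡1+n∸1+i : ∀ {n} (i : Fin n) → n ∸ toℕ i ≡ suc (n ∸ suc (toℕ i))
n∸i≡1+n∸1+i {suc n} zero    = refl
n∸i≡1+n∸1+i {suc n} (suc i) = n∸i≡1+n∸1+i i

antiBits-∷ʳ : ∀ k n l → antiBits k (suc n) l ≡ antiBits k n (not l) ∷ʳ (if suc n <ᵇ k then false else l)
antiBits-∷ʳ k n l = trans (tabulate-∷ʳ n bit) (cong₂ _∷ʳ_ (tabulate-cong earlier-bit) last-bit)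
  where
  bit : Fin (suc n) → Bool
  bit i = if suc (toℕ i) <ᵇ k then false else (if even (suc n ∸ suc (toℕ i)) then l else not l)
  earlier-bit : ∀ (i : Fin n) → bit (inject₁ i)
    ≡ (if suc (toℕ i) <ᵇ k then false else (if even (n ∸ suc (toℕ i)) then not l else not (not l)))
  earlier-bit i rewrite toℕ-inject₁ i | n∸i≡1+n∸1+i i | not-involutive l =
    cong (if suc (toℕ i) <ᵇ k then false else_) (if-not (even (n ∸ suc (toℕ i))))
  last-bit : bit (fromℕ n) ≡ (if suc n <ᵇ k then false else l)
  last-bit rewrite toℕ-fromℕ n | n∸n≡0 n = refl

antiBits-short : ∀ {k n} l → n < k → antiBits k n l ≡ replicate n false
antiBits-short {k} {n} l n<k = trans (tabulate-cong bit-false) (tabulate∘lookup (replicate n false))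
  where
  bit-false : ∀ (i : Fin n) →
    (if suc (toℕ i) <ᵇ k then false else (if even (n ∸ suc (toℕ i)) then l else not l))
      ≡ lookup (replicate n false) i
  bit-false i rewrite Equivalence.to T-≡ (<⇒<ᵇ (≤-<-trans (toℕ<n i) n<k)) = sym (lookup-replicate i false)

≤⇒<ᵇ≡false : ∀ {m n} → n ≤ m → (m <ᵇ n) ≡ false
≤⇒<ᵇ≡false z≤n       = refl
≤⇒<ᵇ≡false (s≤s n≤m) = ≤⇒<ᵇ≡false n≤m

Abar-as-isolated-extension : ∀ k n → antiBits k (suc n) false ≡ antiBits k n true ∷ʳ false
Abar-as-isolated-extension k n =
  trans (antiBits-∷ʳ k n false) (cong (antiBits k n true ∷ʳ_) (if-eta (suc n <ᵇ k)))

A-as-dominating-extension : ∀ k n → k ≤ suc n → antiBits k (suc n) true ≡ antiBits k n false ∷ʳ true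
A-as-dominating-extension k n k≤1+n =
  trans (antiBits-∷ʳ k n true)
        (cong (λ x → antiBits k n false ∷ʳ (if x then false else true)) (≤⇒<ᵇ≡false k≤1+n))

theorem2p2 : (k : ℕ) → 3 ≤ k →
  ((i : ℕ) → 1 ≤ i → i ≤ k ∸ 1 → I (A k i) ≈ₚ onePlusX^ i)
  × ((n : ℕ) → k ∸ 1 ≤ n →
      (I (Abar k (suc n)) ≈ₚ onePlusX* (I (A k n)))
      × (I (A k (suc n)) ≈ₚ (I (Abar k n) +ₚ sumFrom 1 (k ∸ 1) (λ i → mono (n C (i ∸ 1)) i))))
theorem2p2 (suc k') _ = edgeless-prefix , λ n k'≤n → isolated-step n , dominating-step n k'≤n
  where
  k : ℕ
  k = suc k'
  edgeless-prefix : (i : ℕ) → 1 ≤ i → i ≤ k' → I (A k i) ≈ₚ onePlusX^ i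
  edgeless-prefix i _ i≤k' =
    subst (λ b → I (H k b) ≈ₚ onePlusX^ i) (sym (antiBits-short true (s≤s i≤k'))) (I-edgeless k i)
  isolated-step : (n : ℕ) → I (Abar k (suc n)) ≈ₚ onePlusX* (I (A k n))
  isolated-step n =
    subst (λ b → I (H k b) ≈ₚ onePlusX* (I (A k n))) (sym (Abar-as-isolated-extension k n))
          (I-isolated k (antiBits k n true))
  dominating-step : (n : ℕ) → k' ≤ n →
    I (A k (suc n)) ≈ₚ (I (Abar k n) +ₚ sumFrom 1 k' (λ i → mono (n C (i ∸ 1)) i))
  dominating-step n k'≤n =
    subst (λ b → I (H k b) ≈ₚ (I (Abar k n) +ₚ sumFrom 1 k' (λ i → mono (n C (i ∸ 1)) i)))
          (sym (A-as-dominating-extension k n (s≤s k'≤n)))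
          (I-dominating k' (antiBits k n false))
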